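{- Let $G=(V,E)$ be a connected graph on $n$ nodes and let $r\ge1$ be an integer with $r\le\delta(G)$. (i) If $r=1$, then $\overleftarrow{MI}_r(G)=1$. (ii) If $r=2$, then $2\le \overleftarrow{MI}_r(G)\le \frac{n}{1+x}$, where $x=0$ if $n$ is odd and $x=1$ if $n$ is even. (iii) If $r\ge3$, then $r\le \overleftarrow{MI}_r(G)\le n$.
   Context: $\delta(G)$ is the minimum degree of $G$. A configuration is a map $\mathcal{C}:V\to\{b,w\}$ (black/white). In two-way $r$-bootstrap percolation, starting from $\mathcal{C}_0$, in each round $t\ge1$ all nodes update simultaneously: $\mathcal{C}_t(v)=b$ if $v$ has at least $r$ neighbors that are black in $\mathcal{C}_{t-1}$, and $\mathcal{C}_t(v)=w$ otherwise. A set $I\subseteq V$ is an immortal set if for every initial configuration in which all nodes of $I$ are black, in every round $t'\ge0$ at least one node of $V$ is black. $\overleftarrow{MI}_r(G)$ denotes the minimum size of an immortal set in two-way $r$-bootstrap percolation on $G$. Standing assumptions: $r\le\delta(G)$, and $r$ is fixed while $n\to\infty$. -}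

module Defs where

open import Data.Nat using (ℕ; zero; suc; _≤_; _≤ᵇ_; _%_; _≡ᵇ_)
open import Data.Bool using (Bool; true; false; _∧_; if_then_else_)
open import Data.Fin using (Fin)
open import Data.Fin.Subset using (Subset; _∈_; ∣_∣)
open import Data.Vec using (tabulate)
open import Data.Product using (Σ; ∃; _×_)
open import Relation.Binary.PropositionalEquality using (_≡_)

record Graph (n : ℕ) : Set where
  field
    adj   : Fin n → Fin n → Bool
    sym   : ∀ u v → adj u v ≡ adj v u
    irrefl : ∀ v → adj v v ≡ false
open Graph public

N : ∀ {n} → Graph n → Fin n → Subset n
N G v = tabulate (adj G v)

degree : ∀ {n} → Graph n → Fin n → ℕ
degree G v = ∣ N G v ∣

MinDegreeAtLeast : ∀ {n} → ℕ → Graph n → Set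
MinDegreeAtLeast r G = ∀ v → r ≤ degree G v

data Reachable {n} (G : Graph n) : Fin n → Fin n → Set where
  here : ∀ {v} → Reachable G v v
  step : ∀ {u v w} → adj G u v ≡ true → Reachable G v w → Reachable G u w

Connected : ∀ {n} → Graph n → Set
Connected {n} G = ∀ (u v : Fin n) → Reachable G u v

data Colour : Set where
  b w : Colour

isBlack : Colour → Bool
isBlack b = true
isBlack w = false

Configuration : ℕ → Set
Configuration n = Fin n → Colour

blackNeighbours : ∀ {n} → Graph n → Configuration n → Fin n → ℕ
blackNeighbours G C v = ∣ tabulate (λ u → adj G v u ∧ isBlack (C u)) ∣

round : ∀ {n} → ℕ → Graph n → Configuration n → Configuration n
round r G C v = if r ≤ᵇ blackNeighbours G C v then b else w

run : ∀ {n} → ℕ → Graph n → Configuration n → ℕ → Configuration n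
run r G C zero    = C
run r G C (suc t) = round r G (run r G C t)

Immortal : ∀ {n} → ℕ → Graph n → Subset n → Set
Immortal {n} r G I =
  ∀ (C₀ : Configuration n) → (∀ v → v ∈ I → C₀ v ≡ b) →
  ∀ (t : ℕ) → ∃ λ (v : Fin n) → run r G C₀ t v ≡ b

IsMinImmortalSize : ∀ {n} → ℕ → Graph n → ℕ → Set
IsMinImmortalSize {n} r G m =
  (Σ (Subset n) λ I → Immortal r G I × ∣ I ∣ ≡ m) ×
  (∀ (I : Subset n) → Immortal r G I → m ≤ ∣ I ∣)

parityX : ℕ → ℕ
parityX n = if n % 2 ≡ᵇ 0 then 1 else 0

-- A set X is immortal as soon as every vertex of X has r neighbours in some set Y and every vertex
-- of Y has r neighbours in X, for then X and Y are black in alternate rounds.  This gives the upper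
-- bounds: the whole vertex set (as δ ≥ r), one end of an edge (r = 1), and for r = 2 the vertex set
-- of a cycle or a colour class of an even cycle.  Conversely, a vertex that is black in round 1 has
-- r black neighbours, all in the initial black set, so r ≤ ∣ I ∣.  For r = 2 and n even, the chords
-- at the two ends of a maximal path close a Hamiltonian cycle, or two cycles of total length at most
-- n + 1, or three cycles one of which is even; each case yields an immortal set of at most n / 2
-- vertices.  Immortality is decidable, so the minimum exists.
module Submission where

open import Defs hiding (sym)
open import Data.Bool using (Bool; true; false; _∧_; if_then_else_; T)
import Data.Bool.Properties
open import Data.Empty using (⊥-elim)
open import Data.Fin using (Fin; zero; suc; toℕ; funToFin; finToFun)
open import Data.Fin.Properties
  using (pigeonhole; any?; finToFun-funToFin; toℕ<n; toℕ-injective) renaming (_≟_ to _≟ᶠ_)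
import Data.Fin.Properties
open import Data.Fin.Subset
  using (Subset; _∈_; ∣_∣; Nonempty; inside; outside; _∩_; _∪_; ⊤; ⁅_⁆) renaming (⊥ to ∅)
open import Data.Fin.Subset.Properties
  using ( x∈p⇒∣p-x∣<∣p∣; x∈p∧x≢y⇒x∈p-y; p⊆q⇒∣p∣≤∣q∣; x∈p∩q⁺; x∈p∩q⁻; x∈p∪q⁺; x∈p∪q⁻
        ; anySubset?; ∈⊤; x∈⁅x⁆; x∈⁅y⁆⇒x≡y; ∣⊥∣≡0; ∉⊥; ∣⁅x⁆∣≡1; ∣⊤∣≡n )
open import Data.Nat
  using (ℕ; zero; suc; _≤_; _<_; _+_; _∸_; _*_; _^_; z≤n; s≤s; s≤s⁻¹; _≤ᵇ_; _≡ᵇ_; _≤?_; _%_; _/_; NonZero)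
open import Data.Nat.DivMod
  using ( m≡m%n+[m/n]*n; m%n<n; [m+kn]%n≡m%n; m≤n⇒m%n≡m; n%n≡0
        ; %-remove-+ˡ; %-remove-+ʳ; %-distribˡ-+ )
open import Data.Nat.Divisibility using (_∣_; ∣-reflexive; n∣m*n; m∣m*n)
open import Data.Nat.Induction using (<-wellFounded)
open import Data.Nat.Properties
open import Data.Nat.Tactic.RingSolver using (solve-∀)
open import Data.Product using (Σ; ∃; ∃₂; _×_; _,_; proj₁; proj₂; map₂)
open import Data.Sum using (_⊎_; inj₁; inj₂)
open import Data.Vec using ([]; _∷_; tabulate; lookup; here; there)
open import Data.Vec.Properties using (lookup∘tabulate; []=⇒lookup; lookup⇒[]=; tabulate-cong)
open import Function using (_∘_)
open import Function.Bundles using (_⇔_; mk⇔; Equivalence)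
open import Induction.WellFounded using (Acc; acc)
open import Relation.Binary.PropositionalEquality
open import Relation.Nullary using (¬_; ¬?; Dec; yes; no; contradiction)
open import Relation.Nullary.Decidable using (map′; _×-dec_; decidable-stable)

∧-≡true⁻ : ∀ {x y} → x ∧ y ≡ true → x ≡ true × y ≡ true
∧-≡true⁻ {true} y≡true = refl , y≡true

isBlack⁺ : ∀ {c} → c ≡ b → isBlack c ≡ true
isBlack⁺ refl = refl

isBlack⁻ : ∀ {c} → isBlack c ≡ true → c ≡ b
isBlack⁻ {b} _ = refl

∈-tabulate⁺ : ∀ {n} {f : Fin n → Bool} {x} → f x ≡ true → x ∈ tabulate f
∈-tabulate⁺ {f = f} {x} fx = lookup⇒[]= x (tabulate f) (trans (lookup∘tabulate f x) fx)

∈-tabulate⁻ : ∀ {n} {f : Fin n → Bool} {x} → x ∈ tabulate f → f x ≡ true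
∈-tabulate⁻ {f = f} {x} x∈ = trans (sym (lookup∘tabulate f x)) ([]=⇒lookup x∈)

x∈p⇒0<∣p∣ : ∀ {n} {p : Subset n} {x} → x ∈ p → 0 < ∣ p ∣
x∈p⇒0<∣p∣ x∈p = ≤-trans (s≤s z≤n) (x∈p⇒∣p-x∣<∣p∣ x∈p)

x≢y⇒1<∣p∣ : ∀ {n} {p : Subset n} {x y} → x ∈ p → y ∈ p → x ≢ y → 1 < ∣ p ∣
x≢y⇒1<∣p∣ x∈p y∈p x≢y =
  ≤-trans (s≤s (x∈p⇒0<∣p∣ (x∈p∧x≢y⇒x∈p-y y∈p (x≢y ∘ sym)))) (x∈p⇒∣p-x∣<∣p∣ x∈p)

0<∣p∣⇒nonempty : ∀ {n} (p : Subset n) → 0 < ∣ p ∣ → Nonempty p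
0<∣p∣⇒nonempty (inside  ∷ p) _   = zero , here
0<∣p∣⇒nonempty (outside ∷ p) 0<∣p∣ with x , x∈p ← 0<∣p∣⇒nonempty p 0<∣p∣ = suc x , there x∈p

1<∣p∣⇒distinct : ∀ {n} (p : Subset n) → 1 < ∣ p ∣ → ∃₂ λ x y → x ∈ p × y ∈ p × x ≢ y
1<∣p∣⇒distinct (inside ∷ p) (s≤s 0<∣p∣) with y , y∈p ← 0<∣p∣⇒nonempty p 0<∣p∣ =
  zero , suc y , here , there y∈p , λ ()
1<∣p∣⇒distinct (outside ∷ p) 1<∣p∣ with x , y , x∈p , y∈p , x≢y ← 1<∣p∣⇒distinct p 1<∣p∣ =
  suc x , suc y , there x∈p , there y∈p , x≢y ∘ Data.Fin.Properties.suc-injective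

∣p∪q∣≤∣p∣+∣q∣ : ∀ {n} (p q : Subset n) → ∣ p ∪ q ∣ ≤ ∣ p ∣ + ∣ q ∣
∣p∪q∣≤∣p∣+∣q∣ []            []            = z≤n
∣p∪q∣≤∣p∣+∣q∣ (inside  ∷ p) (inside  ∷ q) =
  s≤s (≤-trans (m≤n⇒m≤1+n (∣p∪q∣≤∣p∣+∣q∣ p q)) (≤-reflexive (sym (+-suc _ _))))
∣p∪q∣≤∣p∣+∣q∣ (inside  ∷ p) (outside ∷ q) = s≤s (∣p∪q∣≤∣p∣+∣q∣ p q)
∣p∪q∣≤∣p∣+∣q∣ (outside ∷ p) (inside  ∷ q) =
  ≤-trans (s≤s (∣p∪q∣≤∣p∣+∣q∣ p q)) (≤-reflexive (sym (+-suc _ _)))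
∣p∪q∣≤∣p∣+∣q∣ (outside ∷ p) (outside ∷ q) = ∣p∪q∣≤∣p∣+∣q∣ p q

image : ∀ {n} → (ℕ → Fin n) → ℕ → Subset n
image f zero    = ∅
image f (suc k) = ⁅ f k ⁆ ∪ image f k

module _ {n} (f : ℕ → Fin n) where

  ∣image∣≤ : ∀ k → ∣ image f k ∣ ≤ k
  ∣image∣≤ zero    = ≤-reflexive (∣⊥∣≡0 n)
  ∣image∣≤ (suc k) = ≤-trans (∣p∪q∣≤∣p∣+∣q∣ ⁅ f k ⁆ (image f k))
                             (≤-reflexive-+ (∣⁅x⁆∣≡1 (f k)) (∣image∣≤ k))
    where
    ≤-reflexive-+ : ∀ {a b c} → a ≡ 1 → b ≤ c → a + b ≤ suc c
    ≤-reflexive-+ refl = s≤s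

  ∈-image⁺ : ∀ {s k} → s < k → f s ∈ image f k
  ∈-image⁺ {s} {suc k} s<1+k with m≤n⇒m<n∨m≡n (s≤s⁻¹ s<1+k)
  ... | inj₁ s<k  = x∈p∪q⁺ (inj₂ (∈-image⁺ s<k))
  ... | inj₂ refl = x∈p∪q⁺ (inj₁ (x∈⁅x⁆ (f s)))

  ∈-image⁻ : ∀ {x} k → x ∈ image f k → ∃ λ s → s < k × f s ≡ x
  ∈-image⁻ zero    x∈ = ⊥-elim (∉⊥ x∈)
  ∈-image⁻ (suc k) x∈ with x∈p∪q⁻ ⁅ f k ⁆ (image f k) x∈
  ... | inj₁ x∈⁅fk⁆ = k , ≤-refl , sym (x∈⁅y⁆⇒x≡y (f k) x∈⁅fk⁆)
  ... | inj₂ x∈img  = let s , s<k , fs≡x = ∈-image⁻ k x∈img in s , m≤n⇒m≤1+n s<k , fs≡x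

  ∈-image-periodic : ∀ k .{{_ : NonZero k}} → (∀ s → f (k + s) ≡ f s) → ∀ s → f s ∈ image f k
  ∈-image-periodic k period s = subst (_∈ image f k) (sym f-mod) (∈-image⁺ (m%n<n s k))
    where
    shift : ∀ q m → f (q * k + m) ≡ f m
    shift zero    m = refl
    shift (suc q) m = trans (cong f (+-assoc k (q * k) m)) (trans (period _) (shift q m))

    f-mod : f s ≡ f (s % k)
    f-mod = trans (cong f (trans (m≡m%n+[m/n]*n s k) (+-comm (s % k) _))) (shift (s / k) (s % k))

least-witness : ∀ {P : ℕ → Set} → (∀ k → Dec (P k)) → ∀ {k} → P k →
                ∃ λ m → P m × (∀ {k} → k < m → ¬ P k)
least-witness {P} P? = go (<-wellFounded _)
  where
  go : ∀ {k} → Acc _<_ k → P k → ∃ λ m → P m × (∀ {k} → k < m → ¬ P k)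
  go {k} (acc smaller) Pk with anyUpTo? P? k
  ... | yes (j , j<k , Pj) = go (smaller j<k) Pj
  ... | no none            = k , Pk , λ j<k Pj → none (_ , j<k , Pj)

[1+m]%n≡[1+m%n]%n : ∀ m n .{{_ : NonZero n}} → suc m % n ≡ suc (m % n) % n
[1+m]%n≡[1+m%n]%n m n =
  trans (cong (λ x → suc x % n) (m≡m%n+[m/n]*n m n)) ([m+kn]%n≡m%n (suc (m % n)) (m / n) n)

suc-% : ∀ ℓ p → (p % suc ℓ < ℓ × suc p % suc ℓ ≡ suc (p % suc ℓ))
              ⊎ (p % suc ℓ ≡ ℓ × suc p % suc ℓ ≡ 0)
suc-% ℓ p with m≤n⇒m<n∨m≡n (s≤s⁻¹ (m%n<n p (suc ℓ)))
... | inj₁ q<ℓ  = inj₁ (q<ℓ , trans ([1+m]%n≡[1+m%n]%n p (suc ℓ)) (m≤n⇒m%n≡m q<ℓ))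
... | inj₂ q≡ℓ = inj₂ (q≡ℓ , trans ([1+m]%n≡[1+m%n]%n p (suc ℓ))
                                    (trans (cong (λ q → suc q % suc ℓ) q≡ℓ) (n%n≡0 (suc ℓ))))

%-no-backtrack : ∀ ℓ p → 2 ≤ ℓ → p % suc ℓ ≢ suc (suc p) % suc ℓ
%-no-backtrack (suc zero) p (s≤s ())
%-no-backtrack ℓ@(suc (suc _)) p _ eq with suc-% ℓ p | suc-% ℓ (suc p)
... | inj₁ (_ , e₁) | inj₁ (_ , e₂) =
  <⇒≢ (≤-trans (n<1+n _) (n≤1+n _)) (trans eq (trans e₂ (cong suc e₁)))
... | inj₁ (_ , e₁) | inj₂ (q₁≡ℓ , e₂) =
  contradiction (trans (sym q₁≡ℓ) (trans e₁ (cong suc (trans eq e₂)))) λ ()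
... | inj₂ (q≡ℓ , e₁) | inj₁ (_ , e₂) =
  contradiction (trans (sym q≡ℓ) (trans eq (trans e₂ (cong suc e₁)))) λ ()
... | inj₂ (_ , e₁) | inj₂ (q₁≡ℓ , _) =
  contradiction (trans (sym q₁≡ℓ) e₁) λ ()

parity : ∀ m → m % 2 ≡ 0 ⊎ m % 2 ≡ 1
parity m with m % 2 | m%n<n m 2
... | 0 | _ = inj₁ refl
... | 1 | _ = inj₂ refl
... | suc (suc _) | s≤s (s≤s ())

one-of-three-even : ∀ x y z d → x + y ≡ z + 2 * d → x % 2 ≡ 0 ⊎ y % 2 ≡ 0 ⊎ z % 2 ≡ 0
one-of-three-even x y z d eq with parity x | parity y
... | inj₁ x-even | _ = inj₁ x-even
... | inj₂ _ | inj₁ y-even = inj₂ (inj₁ y-even)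
... | inj₂ x-odd | inj₂ y-odd = inj₂ (inj₂ (begin
  z % 2               ≡⟨ %-remove-+ʳ z (m∣m*n d) ⟨
  (z + 2 * d) % 2     ≡⟨ cong (_% 2) eq ⟨
  (x + y) % 2         ≡⟨ %-distribˡ-+ x y 2 ⟩
  (x % 2 + y % 2) % 2 ≡⟨ cong₂ (λ a c → (a + c) % 2) x-odd y-odd ⟩
  0                   ∎))
  where open ≡-Reasoning

2*m≤1+k⇒2*m≤k : ∀ {m k} → k % 2 ≡ 0 → 2 * m ≤ suc k → 2 * m ≤ k
2*m≤1+k⇒2*m≤k {m} {k} k-even 2m≤ with m≤n⇒m<n∨m≡n 2m≤
... | inj₁ 2m<1+k = s≤s⁻¹ 2m<1+k
... | inj₂ 2m≡1+k = contradiction (begin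
  0                   ≡⟨ %-remove-+ʳ 0 (m∣m*n m) ⟨
  (2 * m) % 2         ≡⟨ cong (_% 2) 2m≡1+k ⟩
  (1 + k) % 2         ≡⟨ %-distribˡ-+ 1 k 2 ⟩
  (1 + k % 2) % 2     ≡⟨ cong (λ r → (1 + r) % 2) k-even ⟩
  1                   ∎) λ ()
  where open ≡-Reasoning

crossing-lengths : ∀ {i j ℓ} → i ≤ j → j ≤ ℓ →
                   suc j + suc (ℓ ∸ i) ≡ suc (i + suc (ℓ ∸ j)) + 2 * (j ∸ i)
crossing-lengths {i} i≤j j≤ℓ with d , refl ← m≤n⇒∃[o]m+o≡n i≤j | a , refl ← m≤n⇒∃[o]m+o≡n j≤ℓ
  rewrite m+n∸m≡n (i + d) a | +-assoc i d a | m+n∸m≡n i (d + a) | m+n∸m≡n i d = identity i d a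
  where
  identity : ∀ i d a → suc (i + d) + suc (d + a) ≡ suc (i + suc a) + 2 * d
  identity = solve-∀

-- Two-way bootstrap percolation

colour-index : Colour → Fin 2
colour-index b = zero
colour-index w = suc zero

colour-index-injective : ∀ {c d} → colour-index c ≡ colour-index d → c ≡ d
colour-index-injective {b} {b} _ = refl
colour-index-injective {w} {w} _ = refl

module _ {n : ℕ} where

  _⊑_ : Configuration n → Configuration n → Set
  C ⊑ C′ = ∀ u → C u ≡ b → C′ u ≡ b

  encode : Configuration n → Fin (2 ^ n)
  encode C = funToFin (colour-index ∘ C)

  encode-injective : ∀ {C C′} → encode C ≡ encode C′ → C ≗ C′
  encode-injective {C} {C′} eq u = colour-index-injective (begin
    colour-index (C u)      ≡⟨ finToFun-funToFin (colour-index ∘ C) u ⟨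
    finToFun (encode C) u   ≡⟨ cong (λ k → finToFun k u) eq ⟩
    finToFun (encode C′) u  ≡⟨ finToFun-funToFin (colour-index ∘ C′) u ⟩
    colour-index (C′ u)     ∎)
    where open ≡-Reasoning

  Alive : Configuration n → Set
  Alive C = ∃ λ v → C v ≡ b

  alive? : ∀ C → Dec (Alive C)
  alive? C = any? λ v → C v ≟ᶜ b
    where
    _≟ᶜ_ : (c d : Colour) → Dec (c ≡ d)
    b ≟ᶜ b = yes refl
    w ≟ᶜ w = yes refl
    b ≟ᶜ w = no λ ()
    w ≟ᶜ b = no λ ()

  χ : Subset n → Configuration n
  χ I u = if lookup I u then b else w

  χ-black⁺ : ∀ {I u} → u ∈ I → χ I u ≡ b
  χ-black⁺ u∈I rewrite []=⇒lookup u∈I = refl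

  χ-black⁻ : ∀ {I u} → χ I u ≡ b → u ∈ I
  χ-black⁻ {I} {u} black with lookup I u in eq
  ... | true = lookup⇒[]= u I eq

Edge : ∀ {n} → Graph n → Fin n → Fin n → Set
Edge G u v = adj G u v ≡ true

module _ {n} (G : Graph n) where

  Edge-sym : ∀ {u v} → Edge G u v → Edge G v u
  Edge-sym {u} {v} e = trans (Graph.sym G v u) e

  Edge-irrefl : ∀ {u v} → Edge G u v → u ≢ v
  Edge-irrefl {u} e refl with () ← trans (sym (irrefl G u)) e

  Supports : ℕ → Subset n → Subset n → Set
  Supports r X Y = ∀ {x} → x ∈ X → r ≤ ∣ N G x ∩ Y ∣

  module _ {C : Configuration n} {v : Fin n} where

    blackNeighbours-≤ : ∀ {p : Subset n} → (∀ {u} → Edge G v u → C u ≡ b → u ∈ p) →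
                        blackNeighbours G C v ≤ ∣ p ∣
    blackNeighbours-≤ h = p⊆q⇒∣p∣≤∣q∣ λ u∈ →
      let e , black = ∧-≡true⁻ (∈-tabulate⁻ u∈) in h e (isBlack⁻ black)

    blackNeighbours-≥ : ∀ {p : Subset n} → (∀ {u} → u ∈ p → Edge G v u × C u ≡ b) →
                        ∣ p ∣ ≤ blackNeighbours G C v
    blackNeighbours-≥ h = p⊆q⇒∣p∣≤∣q∣ λ u∈p →
      let e , black = h u∈p in ∈-tabulate⁺ (cong₂ _∧_ e (isBlack⁺ black))

  module _ (r : ℕ) (C : Configuration n) (v : Fin n) where

    round≡b⁺ : r ≤ blackNeighbours G C v → round r G C v ≡ b
    round≡b⁺ r≤ with r ≤ᵇ blackNeighbours G C v | ≤⇒≤ᵇ r≤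
    ... | true | _ = refl

    round≡b⁻ : round r G C v ≡ b → r ≤ blackNeighbours G C v
    round≡b⁻ _ with r ≤ᵇ blackNeighbours G C v in r≤ᵇ
    ... | true = ≤ᵇ⇒≤ r _ (subst T (sym r≤ᵇ) _)

  module _ (r : ℕ) where

    round-mono : ∀ {C C′} → C ⊑ C′ → round r G C ⊑ round r G C′
    round-mono {C} {C′} C⊑C′ v black =
      round≡b⁺ r C′ v (≤-trans (round≡b⁻ r C v black) (blackNeighbours-≥ λ u∈ →
        let e , black-u = ∧-≡true⁻ (∈-tabulate⁻ u∈) in e , C⊑C′ _ (isBlack⁻ black-u)))

    run-mono : ∀ {C C′} → C ⊑ C′ → ∀ t → run r G C t ⊑ run r G C′ t
    run-mono C⊑C′ zero    = C⊑C′
    run-mono C⊑C′ (suc t) = round-mono (run-mono C⊑C′ t)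

    round-cong : ∀ {C C′} → C ≗ C′ → round r G C ≗ round r G C′
    round-cong C≗C′ v = cong (λ p → if r ≤ᵇ ∣ p ∣ then b else w)
      (tabulate-cong λ u → cong (λ c → adj G v u ∧ isBlack c) (C≗C′ u))

    supports-immortal : ∀ {X Y} → Supports r X Y → Supports r Y X →
                        Nonempty X → Nonempty Y → Immortal r G X
    supports-immortal {X} {Y} X◁Y Y◁X (x , x∈X) (y , y∈Y) C₀ X-black₀ t
      with alternate t
      where
      AllBlack : Subset n → ℕ → Set
      AllBlack Z t = ∀ {z} → z ∈ Z → run r G C₀ t z ≡ b

      propagate : ∀ {Z W} t → Supports r Z W → AllBlack W t → AllBlack Z (suc t)
      propagate t Z◁W W-black {z} z∈Z =
        round≡b⁺ r _ z (≤-trans (Z◁W z∈Z) (blackNeighbours-≥ λ u∈ →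
          let u∈N , u∈W = x∈p∩q⁻ _ _ u∈ in ∈-tabulate⁻ u∈N , W-black u∈W))

      alternate : ∀ t → AllBlack X t ⊎ AllBlack Y t
      alternate zero = inj₁ (X-black₀ _)
      alternate (suc t) with alternate t
      ... | inj₁ X-black = inj₂ (propagate t Y◁X X-black)
      ... | inj₂ Y-black = inj₁ (propagate t X◁Y Y-black)
    ... | inj₁ X-black = x , X-black x∈X
    ... | inj₂ Y-black = y , Y-black y∈Y

    immortal⇒r≤∣I∣ : ∀ {I} → Immortal r G I → r ≤ ∣ I ∣
    immortal⇒r≤∣I∣ {I} immortal with v , black ← immortal (χ I) (λ _ → χ-black⁺) 1 =
      ≤-trans (round≡b⁻ r (χ I) v black) (blackNeighbours-≤ {p = I} λ _ → χ-black⁻)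

    immortal⇔alive : ∀ {I} → Immortal r G I ⇔ (∀ t → Alive (run r G (χ I) t))
    immortal⇔alive {I} = mk⇔
      (λ immortal → immortal (χ I) (λ _ → χ-black⁺))
      (λ alive C₀ I-black t → map₂ (run-mono (λ u → I-black u ∘ χ-black⁻) t _) (alive t))

    run-recurrent : ∀ {C i j} → i < j → run r G C i ≗ run r G C j →
                    ∀ t → ∃ λ s → s < j × run r G C t ≗ run r G C s
    run-recurrent i<j _ zero = 0 , ≤-trans (s≤s z≤n) i<j , λ _ → refl
    run-recurrent {i = i} i<j i~j (suc t) with s , s<j , t~s ← run-recurrent i<j i~j t
      with m≤n⇒m<n∨m≡n s<j
    ... | inj₁ 1+s<j = suc s , 1+s<j , round-cong t~s
    ... | inj₂ refl  = i , i<j , λ u → trans (round-cong t~s u) (sym (i~j u))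

    -- A run visits at most 2 ^ n configurations, so it is alive forever once it is alive that long.
    alive-forever : ∀ C → (∀ {t} → t < suc (2 ^ n) → Alive (run r G C t)) →
                    ∀ t → Alive (run r G C t)
    alive-forever C alive t
      with i , j , i<j , same-code ← pigeonhole (n<1+n (2 ^ n)) (encode ∘ run r G C ∘ toℕ)
      with s , s<j , t~s ← run-recurrent i<j (encode-injective same-code) t
      with v , black ← alive (<-trans s<j (toℕ<n j))
      = v , trans (t~s v) black

    immortal? : ∀ I → Dec (Immortal r G I)
    immortal? I =
      map′ (λ alive → Equivalence.from immortal⇔alive (alive-forever (χ I) (λ {t} → alive {t})))
           (λ immortal {t} _ → Equivalence.to immortal⇔alive immortal t)
           (allUpTo? (alive? ∘ run r G (χ I)) (suc (2 ^ n)))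

    immortal-of-size? : ∀ k → Dec (∃ λ I → Immortal r G I × ∣ I ∣ ≡ k)
    immortal-of-size? k = anySubset? λ I → immortal? I ×-dec (∣ I ∣ ≟ k)

    minimum-exists : ∀ {I} → Immortal r G I → Σ ℕ (IsMinImmortalSize r G)
    minimum-exists immortal
      with m , minimiser , none-smaller ← least-witness immortal-of-size? (_ , immortal , refl)
      = m , minimiser , λ J immortal-J → ≮⇒≥ λ ∣J∣<m → none-smaller ∣J∣<m (J , immortal-J , refl)

    full-immortal : MinDegreeAtLeast r G → Fin n → Immortal r G ⊤
    full-immortal δ≥r x = supports-immortal ⊤◁⊤ ⊤◁⊤ (x , ∈⊤) (x , ∈⊤)
      where
      ⊤◁⊤ : Supports r ⊤ ⊤
      ⊤◁⊤ {v} _ = ≤-trans (δ≥r v) (p⊆q⇒∣p∣≤∣q∣ {p = N G v} λ u∈N → x∈p∩q⁺ (u∈N , ∈⊤))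

  edge-supports : ∀ {x y} → Edge G x y → Supports 1 ⁅ x ⁆ ⁅ y ⁆
  edge-supports {x} {y} e z∈⁅x⁆ rewrite x∈⁅y⁆⇒x≡y x z∈⁅x⁆ =
    x∈p⇒0<∣p∣ (x∈p∩q⁺ (∈-tabulate⁺ e , x∈⁅x⁆ y))

  singleton-immortal : MinDegreeAtLeast 1 G → ∀ x → Immortal 1 G ⁅ x ⁆
  singleton-immortal δ≥1 x with y , y∈N ← 0<∣p∣⇒nonempty (N G x) (δ≥1 x) =
    supports-immortal 1 (edge-supports e) (edge-supports (Edge-sym e)) (x , x∈⁅x⁆ x) (y , x∈⁅x⁆ y)
    where
    e : Edge G x y
    e = ∈-tabulate⁻ y∈N

  -- Immortal sets along closed walks

  two-neighbours-in : ∀ {x y z Y} → Edge G x y → Edge G x z → y ≢ z → y ∈ Y → z ∈ Y →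
                      1 < ∣ N G x ∩ Y ∣
  two-neighbours-in e e′ y≢z y∈Y z∈Y =
    x≢y⇒1<∣p∣ (x∈p∩q⁺ (∈-tabulate⁺ e , y∈Y)) (x∈p∩q⁺ (∈-tabulate⁺ e′ , z∈Y)) y≢z

  -- Along a closed walk without backtracking, the even-indexed and the odd-indexed vertices
  -- support each other: each one sits between two distinct vertices of the other parity.
  module _ (c : ℕ → Fin n) (step : ∀ p → Edge G (c p) (c (suc p)))
           (no-backtrack : ∀ p → c p ≢ c (2 + p))
           (k : ℕ) (period : ∀ p → c (2 * suc k + p) ≡ c p) where

    evens odds : Subset n
    evens = image (λ s → c (2 * s)) (suc k)
    odds  = image (λ s → c (suc (2 * s))) (suc k)

    private
      odd-shift : ∀ m s → suc (2 * (suc m + s)) ≡ 2 * suc m + suc (2 * s)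
      odd-shift = solve-∀

      around-eq : ∀ s m → suc (suc (2 * (s + m))) ≡ 2 * suc m + 2 * s
      around-eq = solve-∀

      ahead-eq : ∀ s m → 2 + suc (2 * (s + m)) ≡ 2 * suc m + suc (2 * s)
      ahead-eq = solve-∀

      c≡ : ∀ {p q} → p ≡ q → c p ≡ c q
      c≡ = cong c

      ∈-evens : ∀ s → c (2 * s) ∈ evens
      ∈-evens = ∈-image-periodic (λ s → c (2 * s)) (suc k) λ s →
        trans (c≡ (*-distribˡ-+ 2 (suc k) s)) (period (2 * s))

      ∈-odds : ∀ s → c (suc (2 * s)) ∈ odds
      ∈-odds = ∈-image-periodic (λ s → c (suc (2 * s))) (suc k) λ s →
        trans (c≡ (odd-shift k s)) (period (suc (2 * s)))

    evens◁odds : Supports 2 evens odds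
    evens◁odds x∈ with s , _ , refl ← ∈-image⁻ _ (suc k) x∈ =
      two-neighbours-in (step (2 * s)) back (λ eq → no-backtrack p (trans (sym eq) (sym ahead)))
                        (∈-odds s) (∈-odds (s + k))
      where
      p = suc (2 * (s + k))
      around : c (suc p) ≡ c (2 * s)
      around = trans (c≡ (around-eq s k)) (period (2 * s))
      ahead : c (2 + p) ≡ c (suc (2 * s))
      ahead = trans (c≡ (ahead-eq s k)) (period (suc (2 * s)))
      back : Edge G (c (2 * s)) (c p)
      back = Edge-sym (subst (Edge G (c p)) around (step p))

    odds◁evens : Supports 2 odds evens
    odds◁evens y∈ with s , _ , refl ← ∈-image⁻ _ (suc k) y∈ =
      two-neighbours-in (Edge-sym (step (2 * s))) (subst (Edge G _) (c≡ (sym next)) (step (suc (2 * s))))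
                        (λ eq → no-backtrack (2 * s) (trans eq (c≡ next))) (∈-evens s) (∈-evens (suc s))
      where
      next : 2 * suc s ≡ 2 + 2 * s
      next = *-suc 2 s

    walk-immortal : Immortal 2 G evens
    walk-immortal = supports-immortal 2 evens◁odds odds◁evens (_ , ∈-evens 0) (_ , ∈-odds 0)

-- Paths and cycles

module Paths {n} (G : Graph n) where

  record Path : Set where
    field
      len       : ℕ
      vertex    : ℕ → Fin n
      injective : ∀ {p q} → p ≤ len → q ≤ len → vertex p ≡ vertex q → p ≡ q
      linked    : ∀ {p} → p < len → Edge G (vertex p) (vertex (suc p))

  open Path public

  first last : Path → Fin n
  first P = vertex P 0
  last  P = vertex P (len P)

  infix 4 _∈ᵥ_ _∈ᵥ?_

  _∈ᵥ_ : Fin n → Path → Set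
  u ∈ᵥ P = ∃ λ p → p ≤ len P × vertex P p ≡ u

  _∈ᵥ?_ : ∀ u P → Dec (u ∈ᵥ P)
  u ∈ᵥ? P = map′ (λ (p , p<1+ℓ , eq) → p , s≤s⁻¹ p<1+ℓ , eq)
                 (λ (p , p≤ℓ , eq) → p , s≤s p≤ℓ , eq)
                 (anyUpTo? (λ p → vertex P p ≟ᶠ u) (suc (len P)))

  Edge-cong : ∀ {u u′ v v′} → u ≡ u′ → v ≡ v′ → Edge G u v → Edge G u′ v′
  Edge-cong refl refl e = e

  len<n : ∀ P → len P < n
  len<n P = Data.Fin.Properties.injective⇒≤ {f = vertex P ∘ toℕ} λ eq →
    toℕ-injective (injective P (≤-pred (toℕ<n _)) (≤-pred (toℕ<n _)) eq)

  single : Fin n → Path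
  single x = record
    { len = 0 ; vertex = λ _ → x ; linked = λ ()
    ; injective = λ p≤0 q≤0 _ → trans (n≤0⇒n≡0 p≤0) (sym (n≤0⇒n≡0 q≤0)) }

  take : ∀ P i → i ≤ len P → Path
  take P i i≤ℓ = record
    { len = i ; vertex = vertex P
    ; injective = λ p≤i q≤i → injective P (≤-trans p≤i i≤ℓ) (≤-trans q≤i i≤ℓ)
    ; linked = λ p<i → linked P (≤-trans p<i i≤ℓ) }

  drop : ∀ P i → i ≤ len P → Path
  drop P i i≤ℓ = record
    { len = len P ∸ i ; vertex = λ p → vertex P (i + p)
    ; injective = λ p≤ q≤ eq → +-cancelˡ-≡ i _ _ (injective P (shifted p≤) (shifted q≤) eq)
    ; linked = λ {p} p< → Edge-cong refl (cong (vertex P) (sym (+-suc i p)))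
                            (linked P (≤-trans (≤-reflexive (sym (+-suc i p))) (shifted p<))) }
    where
    shifted : ∀ {p} → p ≤ len P ∸ i → i + p ≤ len P
    shifted p≤ = ≤-trans (+-monoʳ-≤ i p≤) (≤-reflexive (m+[n∸m]≡n i≤ℓ))

  reverse : Path → Path
  reverse P = record
    { len = len P ; vertex = λ p → vertex P (len P ∸ p)
    ; injective = λ {p} {q} p≤ q≤ eq → ∸-cancelˡ-≡ p≤ q≤ (injective P (m∸n≤m _ p) (m∸n≤m _ q) eq)
    ; linked = reversed-linked }
    where
    reversed-linked : ∀ {p} → p < len P → Edge G (vertex P (len P ∸ p)) (vertex P (len P ∸ suc p))
    reversed-linked {p} p<ℓ = Edge-cong (cong (vertex P) (sym ℓ∸p)) refl
                                        (Edge-sym G (linked P (≤-trans (≤-reflexive (sym ℓ∸p)) (m∸n≤m _ p))))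
      where
      ℓ∸p : len P ∸ p ≡ suc (len P ∸ suc p)
      ℓ∸p = +-∸-assoc 1 p<ℓ

  split-index : ∀ {k m p} → p ≤ k + suc m → p ≤ k ⊎ ∃ λ q → q ≤ m × p ≡ suc k + q
  split-index {k} {m} {p} p≤ with p ≤? k
  ... | yes p≤k = inj₁ p≤k
  ... | no  p≰k =
    inj₂ (p ∸ suc k , +-cancelˡ-≤ (suc k) _ _ (subst₂ _≤_ (sym p≡) (+-suc k m) p≤) , sym p≡)
    where
    p≡ : suc k + (p ∸ suc k) ≡ p
    p≡ = m+[n∸m]≡n (≰⇒> p≰k)

  module _ (P Q : Path) where

    spliced : ℕ → Fin n
    spliced p with p ≤? len P
    ... | yes _ = vertex P p
    ... | no  _ = vertex Q (p ∸ suc (len P))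

    spliced-left : ∀ {p} → p ≤ len P → spliced p ≡ vertex P p
    spliced-left {p} p≤ with p ≤? len P
    ... | yes _   = refl
    ... | no  p≰ = contradiction p≤ p≰

    spliced-right : ∀ q → spliced (suc (len P) + q) ≡ vertex Q q
    spliced-right q with suc (len P) + q ≤? len P
    ... | yes p≤ = contradiction p≤ (<⇒≱ (s≤s (m≤m+n (len P) q)))
    ... | no  _  = cong (vertex Q) (m+n∸m≡n (suc (len P)) q)

  append : ∀ P Q → Edge G (last P) (first Q) → (∀ {u} → u ∈ᵥ P → ¬ u ∈ᵥ Q) → Path
  append P Q join disjoint = record
    { len = len P + suc (len Q) ; vertex = spliced P Q ; injective = injective′ ; linked = linked′ }
    where
    injective′ : ∀ {p q} → p ≤ len P + suc (len Q) → q ≤ len P + suc (len Q) →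
                 spliced P Q p ≡ spliced P Q q → p ≡ q
    injective′ p≤ q≤ eq with split-index p≤ | split-index q≤
    ... | inj₁ p≤k | inj₁ q≤k =
      injective P p≤k q≤k (trans (sym (spliced-left P Q p≤k)) (trans eq (spliced-left P Q q≤k)))
    ... | inj₁ p≤k | inj₂ (q′ , q′≤ , refl) = ⊥-elim (disjoint (_ , p≤k , refl)
      (q′ , q′≤ , trans (sym (spliced-right P Q q′)) (trans (sym eq) (spliced-left P Q p≤k))))
    ... | inj₂ (p′ , p′≤ , refl) | inj₁ q≤k = ⊥-elim (disjoint (_ , q≤k , refl)
      (p′ , p′≤ , trans (sym (spliced-right P Q p′)) (trans eq (spliced-left P Q q≤k))))
    ... | inj₂ (p′ , p′≤ , refl) | inj₂ (q′ , q′≤ , refl) = cong (suc (len P) +_)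
      (injective Q p′≤ q′≤ (trans (sym (spliced-right P Q p′)) (trans eq (spliced-right P Q q′))))

    linked′ : ∀ {p} → p < len P + suc (len Q) → Edge G (spliced P Q p) (spliced P Q (suc p))
    linked′ {p} p< with split-index p<
    ... | inj₁ p<k =
      Edge-cong (sym (spliced-left P Q (<⇒≤ p<k))) (sym (spliced-left P Q p<k)) (linked P p<k)
    ... | inj₂ (zero , _ , 1+p≡) rewrite suc-injective (trans 1+p≡ (+-identityʳ _)) =
      Edge-cong (sym (spliced-left P Q ≤-refl)) (sym right-start) join
      where
      right-start : spliced P Q (suc (len P)) ≡ first Q
      right-start = trans (cong (spliced P Q ∘ suc) (sym (+-identityʳ (len P)))) (spliced-right P Q 0)
    ... | inj₂ (suc q , q< , 1+p≡) rewrite suc-injective (trans 1+p≡ (cong suc (+-suc (len P) q))) =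
      Edge-cong (sym (spliced-right P Q q)) (sym right-next) (linked Q q<)
      where
      right-next : spliced P Q (suc (suc (len P + q))) ≡ vertex Q (suc q)
      right-next = trans (cong (spliced P Q ∘ suc) (sym (+-suc (len P) q))) (spliced-right P Q (suc q))

  module _ (P Q : Path) (join : Edge G (last P) (first Q))
           (disjoint : ∀ {u} → u ∈ᵥ P → ¬ u ∈ᵥ Q) where

    first-append : first (append P Q join disjoint) ≡ first P
    first-append = spliced-left P Q z≤n

    last-append : last (append P Q join disjoint) ≡ last Q
    last-append = trans (cong (spliced P Q) (+-suc (len P) (len Q))) (spliced-right P Q (len Q))

    ∈-append⁻ : ∀ {u} → u ∈ᵥ append P Q join disjoint → u ∈ᵥ P ⊎ u ∈ᵥ Q
    ∈-append⁻ (p , p≤ , refl) with split-index p≤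
    ... | inj₁ p≤k             = inj₁ (p , p≤k , sym (spliced-left P Q p≤k))
    ... | inj₂ (q , q≤ , refl) = inj₂ (q , q≤ , sym (spliced-right P Q q))

  module _ (P : Path) (i : ℕ) (i≤ℓ : i ≤ len P) where

    first-drop : first (drop P i i≤ℓ) ≡ vertex P i
    first-drop = cong (vertex P) (+-identityʳ i)

    last-drop : last (drop P i i≤ℓ) ≡ last P
    last-drop = cong (vertex P) (m+[n∸m]≡n i≤ℓ)

    ∈-drop⁻ : ∀ {u} → u ∈ᵥ drop P i i≤ℓ → ∃ λ q → i + q ≤ len P × vertex P (i + q) ≡ u
    ∈-drop⁻ (q , q≤ , eq) = q , ≤-trans (+-monoʳ-≤ i q≤) (≤-reflexive (m+[n∸m]≡n i≤ℓ)) , eq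

    ∈-take⁻ : ∀ {u} → u ∈ᵥ take P i i≤ℓ → u ∈ᵥ P
    ∈-take⁻ (p , p≤i , eq) = p , ≤-trans p≤i i≤ℓ , eq

  take-drop-disjoint : ∀ P {i j} i≤ℓ j≤ℓ {u} → i < j → u ∈ᵥ take P i i≤ℓ → ¬ u ∈ᵥ drop P j j≤ℓ
  take-drop-disjoint P i≤ℓ j≤ℓ i<j (p , p≤i , refl) u∈drop
    with q , j+q≤ , eq ← ∈-drop⁻ P _ j≤ℓ u∈drop =
    <⇒≱ (≤-trans (s≤s p≤i) i<j)
        (≤-trans (m≤m+n _ q) (≤-reflexive (injective P j+q≤ (≤-trans p≤i i≤ℓ) eq)))

  last-reverse : ∀ P → last (reverse P) ≡ first P
  last-reverse P = cong (vertex P) (n∸n≡0 (len P))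

  ∈-reverse⁻ : ∀ P {u} → u ∈ᵥ reverse P → u ∈ᵥ P
  ∈-reverse⁻ P (p , _ , eq) = len P ∸ p , m∸n≤m _ p , eq

  cons : ∀ u P → Edge G u (first P) → ¬ u ∈ᵥ P → Path
  cons u P e u∉P = append (single u) P e λ (_ , _ , u≡v) v∈P → u∉P (subst (_∈ᵥ P) (sym u≡v) v∈P)

  module _ (P : Path) (closed : Edge G (last P) (first P)) (p : ℕ) (p<ℓ : p < len P) where

    private
      tail = drop P (suc p) p<ℓ
      head = take P p (<⇒≤ p<ℓ)

      wrap : Edge G (last tail) (first head)
      wrap = Edge-cong (sym (last-drop P (suc p) p<ℓ)) refl closed

      tail∩head : ∀ {u} → u ∈ᵥ tail → ¬ u ∈ᵥ head
      tail∩head u∈tail u∈head = take-drop-disjoint P (<⇒≤ p<ℓ) p<ℓ ≤-refl u∈head u∈tail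

    rotate : Path
    rotate = append tail head wrap tail∩head

    len-rotate : len rotate ≡ len P
    len-rotate = m∸n+n≡m p<ℓ

    first-rotate : first rotate ≡ vertex P (suc p)
    first-rotate = trans (first-append tail head wrap tail∩head) (first-drop P (suc p) p<ℓ)

    ∈-rotate⁻ : ∀ {u} → u ∈ᵥ rotate → u ∈ᵥ P
    ∈-rotate⁻ u∈ with ∈-append⁻ tail head wrap tail∩head u∈
    ... | inj₁ u∈tail = let q , q≤ , eq = ∈-drop⁻ P (suc p) p<ℓ u∈tail in _ , q≤ , eq
    ... | inj₂ u∈head = ∈-take⁻ P p (<⇒≤ p<ℓ) u∈head

  Saturated : Path → Fin n → Set
  Saturated P x = ∀ {u} → Edge G x u → u ∈ᵥ P

  Escape : Path → Fin n → Set
  Escape P x = ∃ λ u → Edge G x u × ¬ u ∈ᵥ P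

  escape? : ∀ P x → Dec (Escape P x)
  escape? P x = any? λ u → (adj G x u Data.Bool.Properties.≟ true) ×-dec ¬? (u ∈ᵥ? P)

  ¬escape⇒saturated : ∀ P {x} → ¬ Escape P x → Saturated P x
  ¬escape⇒saturated P ¬escape {u} e = decidable-stable (u ∈ᵥ? P) λ u∉P → ¬escape (u , e , u∉P)

  record Maximal (P : Path) : Set where
    field
      first-saturated  : Saturated P (first P)
      last-saturated   : Saturated P (last P)
      closed⇒saturated : Edge G (last P) (first P) → ∀ {p} → p ≤ len P → Saturated P (vertex P p)

  private
    longer : ∀ {P} Q {fuel} → n ≤ len P + suc fuel → len Q ≡ suc (len P) → n ≤ len Q + fuel
    longer {P} Q {fuel} n≤ eq =
      ≤-trans n≤ (≤-reflexive (trans (+-suc (len P) fuel) (cong (_+ fuel) (sym eq))))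

  -- Extend at either end while possible; a closed path with an escaping vertex is rotated to
  -- start there first.  Every step lengthens the path, and no path has n vertices.
  grow : ∀ fuel P → n ≤ len P + fuel → Σ Path Maximal
  grow zero P n≤ = ⊥-elim (<⇒≱ (len<n P) (subst (n ≤_) (+-identityʳ _) n≤))
  grow (suc fuel) P n≤
    with escape? P (first P) | escape? P (last P)
       | adj G (last P) (first P) Data.Bool.Properties.≟ true
       | anyUpTo? (λ p → escape? P (vertex P p)) (suc (len P))
  ... | yes (u , e , u∉P) | _ | _ | _ =
    let Q = cons u P (Edge-sym G e) u∉P in grow fuel Q (longer {P} Q n≤ refl)
  ... | no _ | yes (u , e , u∉P) | _ | _ =
    let Q = cons u (reverse P) (Edge-sym G e) (u∉P ∘ ∈-reverse⁻ P)
    in grow fuel Q (longer {P} Q n≤ refl)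
  ... | no first-stuck | no last-stuck | no not-closed | _ =
    P , record { first-saturated = ¬escape⇒saturated P first-stuck
               ; last-saturated = ¬escape⇒saturated P last-stuck
               ; closed⇒saturated = λ closed → ⊥-elim (not-closed closed) }
  ... | no first-stuck | no last-stuck | yes _ | no inner-stuck =
    P , record { first-saturated = ¬escape⇒saturated P first-stuck
               ; last-saturated = ¬escape⇒saturated P last-stuck
               ; closed⇒saturated = λ _ p≤ →
                   ¬escape⇒saturated P λ escape → inner-stuck (_ , s≤s p≤ , escape) }
  ... | no first-stuck | no _ | yes _ | yes (zero , _ , escape) = ⊥-elim (first-stuck escape)
  ... | no _ | no _ | yes closed | yes (suc p , s≤s p<ℓ , u , e , u∉P) =
    let Q = cons u (rotate P closed p p<ℓ)
                   (Edge-sym G (Edge-cong (sym (first-rotate P closed p p<ℓ)) refl e))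
                   (u∉P ∘ ∈-rotate⁻ P closed p p<ℓ)
    in grow fuel Q (longer {P} Q n≤ (cong suc (len-rotate P closed p p<ℓ)))

  maximal-path : Fin n → Σ Path Maximal
  maximal-path x = grow n (single x) ≤-refl

  saturated⇒covers : Connected G → ∀ P → (∀ {p} → p ≤ len P → Saturated P (vertex P p)) →
                     ∀ u → u ∈ᵥ P
  saturated⇒covers connected P saturated u = along (connected (first P) u) (0 , z≤n , refl)
    where
    along : ∀ {x y} → Reachable G x y → x ∈ᵥ P → y ∈ᵥ P
    along here         x∈P            = x∈P
    along (step e walk) (p , p≤ , refl) = along walk (saturated p≤ e)

  covers⇒n≤ : ∀ P → (∀ u → u ∈ᵥ P) → n ≤ suc (len P)
  covers⇒n≤ P covers = Data.Fin.Properties.injective⇒≤ {f = slot} λ {u} {v} eq →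
    trans (sym (position u)) (trans (cong (vertex P) (same-position eq)) (position v))
    where
    slot : Fin n → Fin (suc (len P))
    slot u = Data.Fin.fromℕ< (s≤s (proj₁ (proj₂ (covers u))))
    position : ∀ u → vertex P (proj₁ (covers u)) ≡ u
    position u = proj₂ (proj₂ (covers u))
    same-position : ∀ {u v} → slot u ≡ slot v → proj₁ (covers u) ≡ proj₁ (covers v)
    same-position {u} {v} eq = trans (sym (Data.Fin.Properties.toℕ-fromℕ< _))
                                     (trans (cong toℕ eq) (Data.Fin.Properties.toℕ-fromℕ< _))

  record Cycle : Set where
    field
      path    : Path
      closing : Edge G (last path) (first path)
      long    : 2 ≤ len path

  length : Cycle → ℕ
  length C = suc (len (Cycle.path C))

  module _ (C : Cycle) where
    open Cycle C

    private
      walk : ℕ → Fin n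
      walk p = vertex path (p % length C)

      walk-step : ∀ p → Edge G (walk p) (walk (suc p))
      walk-step p with suc-% (len path) p
      ... | inj₁ (q<ℓ , e) = Edge-cong refl (cong (vertex path) (sym e)) (linked path q<ℓ)
      ... | inj₂ (q≡ℓ , e) =
        Edge-cong (cong (vertex path) (sym q≡ℓ)) (cong (vertex path) (sym e)) closing

      walk-no-backtrack : ∀ p → walk p ≢ walk (2 + p)
      walk-no-backtrack p eq =
        %-no-backtrack (len path) p long (injective path (bound p) (bound (2 + p)) eq)
        where
        bound : ∀ p → p % length C ≤ len path
        bound p = s≤s⁻¹ (m%n<n p (length C))

    cycle-immortal : ∀ k → length C ∣ 2 * suc k → ∃ λ I → Immortal 2 G I × ∣ I ∣ ≤ suc k
    cycle-immortal k L∣2k = evens G walk walk-step walk-no-backtrack k period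
                          , walk-immortal G walk walk-step walk-no-backtrack k period
                          , ∣image∣≤ (λ s → walk (2 * s)) (suc k)
      where
      period : ∀ p → walk (2 * suc k + p) ≡ walk p
      period p = cong (vertex path) (%-remove-+ˡ p L∣2k)

    even-cycle-immortal : length C % 2 ≡ 0 → ∃ λ I → Immortal 2 G I × 2 * ∣ I ∣ ≤ length C
    even-cycle-immortal even = from-half (length C / 2) L≡2h
      where
      L≡2h : length C ≡ 2 * (length C / 2)
      L≡2h = trans (m≡m%n+[m/n]*n (length C) 2)
                   (trans (cong (_+ (length C / 2) * 2) even) (*-comm (length C / 2) 2))

      from-half : ∀ h → length C ≡ 2 * h → ∃ λ I → Immortal 2 G I × 2 * ∣ I ∣ ≤ length C
      from-half (suc k) L≡ with I , immortal , ∣I∣≤ ← cycle-immortal k (∣-reflexive L≡) =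
        I , immortal , ≤-trans (*-monoʳ-≤ 2 ∣I∣≤) (≤-reflexive (sym L≡))

  HalfImmortal : Set
  HalfImmortal = ∃ λ I → Immortal 2 G I × 2 * ∣ I ∣ ≤ n

  even-cycle-half : ∀ C → length C % 2 ≡ 0 → HalfImmortal
  even-cycle-half C even with I , immortal , 2∣I∣≤L ← even-cycle-immortal C even =
    I , immortal , ≤-trans 2∣I∣≤L (len<n (Cycle.path C))

  short-cycle-half : n % 2 ≡ 0 → ∀ C → length C + length C ≤ suc n → HalfImmortal
  short-cycle-half n-even C 2L≤
    with I , immortal , ∣I∣≤L ← cycle-immortal C (len (Cycle.path C)) (n∣m*n 2) =
    I , immortal , 2*m≤1+k⇒2*m≤k {∣ I ∣} n-even
      (≤-trans (*-monoʳ-≤ 2 ∣I∣≤L) (≤-trans (≤-reflexive (cong (length C +_) (+-identityʳ _))) 2L≤))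

  two-cycles-half : n % 2 ≡ 0 → ∀ C D → length C + length D ≤ suc n → HalfImmortal
  two-cycles-half n-even C D L+L′≤ with length C ≤? length D
  ... | yes L≤L′ = short-cycle-half n-even C (≤-trans (+-monoʳ-≤ (length C) L≤L′) L+L′≤)
  ... | no  L≰L′ =
    short-cycle-half n-even D (≤-trans (+-monoˡ-≤ (length D) (<⇒≤ (≰⇒> L≰L′))) L+L′≤)

  front-cycle : ∀ P {j} → 2 ≤ j → (j≤ℓ : j ≤ len P) → Edge G (first P) (vertex P j) → Cycle
  front-cycle P 2≤j j≤ℓ front =
    record { path = take P _ j≤ℓ ; closing = Edge-sym G front ; long = 2≤j }

  back-cycle : ∀ P {i} → 2 + i ≤ len P → Edge G (last P) (vertex P i) → Cycle
  back-cycle P {i} 2+i≤ℓ back = record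
    { path = drop P i i≤ℓ
    ; closing = Edge-cong (sym (last-drop P i i≤ℓ)) (sym (first-drop P i i≤ℓ)) back
    ; long = ≤-trans (≤-reflexive (sym (m+n∸n≡m 2 i))) (∸-monoˡ-≤ i 2+i≤ℓ) }
    where
    i≤ℓ : i ≤ len P
    i≤ℓ = m+n≤o⇒n≤o 2 2+i≤ℓ

  -- v₀ … vᵢ followed by v_ℓ … vⱼ, closed by the two chords.
  crossing-cycle : ∀ P {i j} → 0 < i → i < j → (j≤ℓ : j ≤ len P) →
                   Edge G (first P) (vertex P j) → Edge G (last P) (vertex P i) → Cycle
  crossing-cycle P {i} {j} 0<i i<j j≤ℓ front back = record
    { path = append head tail′ join head∩tail
    ; closing = Edge-cong (sym (trans (last-append head tail′ join head∩tail)
                                      (trans (last-reverse tail) (first-drop P j j≤ℓ))))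
                          (sym (first-append head tail′ join head∩tail))
                          (Edge-sym G front)
    ; long = ≤-trans (s≤s (≤-trans 0<i (m≤m+n i _))) (≤-reflexive (sym (+-suc i _))) }
    where
    head = take P i (<⇒≤ (≤-trans i<j j≤ℓ))
    tail = drop P j j≤ℓ
    tail′ = reverse tail

    join : Edge G (last head) (first tail′)
    join = Edge-cong refl (sym (last-drop P j j≤ℓ)) (Edge-sym G back)

    head∩tail : ∀ {u} → u ∈ᵥ head → ¬ u ∈ᵥ tail′
    head∩tail u∈head u∈tail′ =
      take-drop-disjoint P (<⇒≤ (≤-trans i<j j≤ℓ)) j≤ℓ i<j u∈head (∈-reverse⁻ tail u∈tail′)

  -- Chords at the ends of a maximal path

  chord-≢ : ∀ P {a q} → Edge G (vertex P a) (vertex P q) → q ≢ a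
  chord-≢ P e q≡a = Edge-irrefl G e (cong (vertex P) (sym q≡a))

  module _ (δ≥2 : MinDegreeAtLeast 2 G) where

    saturated-chord : ∀ P {a} → Saturated P (vertex P a) → ∀ c →
                      ∃ λ q → q ≤ len P × q ≢ a × q ≢ c × Edge G (vertex P a) (vertex P q)
    saturated-chord P {a} saturated c
      with x , y , x∈N , y∈N , x≢y ← 1<∣p∣⇒distinct (N G (vertex P a)) (δ≥2 (vertex P a))
      with p , p≤ , refl ← saturated (∈-tabulate⁻ x∈N) | q , q≤ , refl ← saturated (∈-tabulate⁻ y∈N)
      with p ≟ c
    ... | no p≢c   = p , p≤ , chord-≢ P (∈-tabulate⁻ x∈N) , p≢c , ∈-tabulate⁻ x∈N
    ... | yes refl = q , q≤ , chord-≢ P (∈-tabulate⁻ y∈N) , (λ q≡p → x≢y (cong (vertex P) (sym q≡p)))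
                   , ∈-tabulate⁻ y∈N

    front-chord : ∀ P → Maximal P → ∃ λ j → 2 ≤ j × j ≤ len P × Edge G (first P) (vertex P j)
    front-chord P maximal with saturated-chord P (Maximal.first-saturated maximal) 1
    ... | zero , _ , q≢0 , _ , _           = contradiction refl q≢0
    ... | suc zero , _ , _ , q≢1 , _       = contradiction refl q≢1
    ... | suc (suc q) , q≤ , _ , _ , chord = suc (suc q) , s≤s (s≤s z≤n) , q≤ , chord

    back-chord : ∀ P → Maximal P → ∃ λ i → 2 + i ≤ len P × Edge G (last P) (vertex P i)
    back-chord P maximal
      with q , q≤ , q≢ℓ , q≢ℓ-1 , chord ← saturated-chord P (Maximal.last-saturated maximal) (len P ∸ 1) =
      q , ≤∧≢⇒< (≤∧≢⇒< q≤ q≢ℓ) (λ 1+q≡ℓ → q≢ℓ-1 (cong (_∸ 1) 1+q≡ℓ)) , chord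

    module _ (n-even : n % 2 ≡ 0) where

      closed-maximal-half : Connected G → ∀ P → Maximal P → 2 ≤ len P → Edge G (last P) (first P) →
                            HalfImmortal
      closed-maximal-half connected P maximal 2≤ℓ closed =
        even-cycle-half C (subst (λ L → L % 2 ≡ 0) L≡n n-even)
        where
        C : Cycle
        C = record { path = P ; closing = closed ; long = 2≤ℓ }
        L≡n : n ≡ length C
        L≡n = ≤-antisym (covers⇒n≤ P (saturated⇒covers connected P (Maximal.closed⇒saturated maximal closed)))
                        (len<n P)

      disjoint-chords-half : ∀ P {i j} → 2 ≤ j → j ≤ i → 2 + i ≤ len P →
                             Edge G (first P) (vertex P j) → Edge G (last P) (vertex P i) → HalfImmortal
      disjoint-chords-half P {i} {j} 2≤j j≤i 2+i≤ℓ front back =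
        two-cycles-half n-even (front-cycle P 2≤j j≤ℓ front) (back-cycle P 2+i≤ℓ back) (begin
          suc j + suc (len P ∸ i)   ≡⟨ +-suc (suc j) _ ⟩
          2 + (j + (len P ∸ i))     ≤⟨ s≤s (s≤s (+-monoˡ-≤ _ j≤i)) ⟩
          2 + (i + (len P ∸ i))     ≡⟨ cong (2 +_) (m+[n∸m]≡n i≤ℓ) ⟩
          2 + len P                 ≤⟨ s≤s (len<n P) ⟩
          suc n                     ∎)
        where
        open ≤-Reasoning
        i≤ℓ = m+n≤o⇒n≤o 2 2+i≤ℓ
        j≤ℓ = ≤-trans j≤i i≤ℓ

      crossing-chords-half : ∀ P {i j} → 0 < i → i < j → 2 ≤ j → j ≤ len P → 2 + i ≤ len P →
                             Edge G (first P) (vertex P j) → Edge G (last P) (vertex P i) → HalfImmortal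
      crossing-chords-half P {i} {j} 0<i i<j 2≤j j≤ℓ 2+i≤ℓ front back
        with one-of-three-even (suc j) (suc (len P ∸ i)) (suc (i + suc (len P ∸ j))) (j ∸ i)
                               (crossing-lengths (<⇒≤ i<j) j≤ℓ)
      ... | inj₁ A-even          = even-cycle-half (front-cycle P 2≤j j≤ℓ front) A-even
      ... | inj₂ (inj₁ B-even)   = even-cycle-half (back-cycle P 2+i≤ℓ back) B-even
      ... | inj₂ (inj₂ D-even)   = even-cycle-half (crossing-cycle P 0<i i<j j≤ℓ front back) D-even

      chords-half : Connected G → ∀ P → Maximal P →
                    ∀ {j} → 2 ≤ j → j ≤ len P → Edge G (first P) (vertex P j) →
                    ∀ i → 2 + i ≤ len P → Edge G (last P) (vertex P i) → HalfImmortal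
      chords-half connected P maximal 2≤j j≤ℓ front zero 2≤ℓ back =
        closed-maximal-half connected P maximal 2≤ℓ back
      chords-half connected P maximal {j} 2≤j j≤ℓ front i@(suc _) 2+i≤ℓ back with j ≤? i
      ... | yes j≤i = disjoint-chords-half P 2≤j j≤i 2+i≤ℓ front back
      ... | no  j≰i = crossing-chords-half P (s≤s z≤n) (≰⇒> j≰i) 2≤j j≤ℓ 2+i≤ℓ front back

      even-order-half : Connected G → Fin n → HalfImmortal
      even-order-half connected x
        with P , maximal ← maximal-path x
        with j , 2≤j , j≤ℓ , front ← front-chord P maximal
        with i , 2+i≤ℓ , back ← back-chord P maximal
        = chords-half connected P maximal 2≤j j≤ℓ front i 2+i≤ℓ back

open Paths using (even-order-half)

minimum-parity-bound : ∀ {n} (G : Graph n) {m} → (∀ I → Immortal 2 G I → m ≤ ∣ I ∣) →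
                       MinDegreeAtLeast 2 G → Connected G → Fin n → m ≤ n → m * (1 + parityX n) ≤ n
minimum-parity-bound {n} G {m} minimal δ≥2 connected x m≤n with n % 2 ≡ᵇ 0 in n-even
... | false = subst (_≤ n) (sym (*-identityʳ _)) m≤n
... | true
  with I , immortal , 2∣I∣≤n ← even-order-half G δ≥2 (≡ᵇ⇒≡ (n % 2) 0 (subst T (sym n-even) _)) connected x =
  ≤-trans (≤-reflexive (*-comm m 2)) (≤-trans (*-monoʳ-≤ 2 (minimal I immortal)) 2∣I∣≤n)

theorem8 : ∀ (n : ℕ) (G : Graph n) (r : ℕ) →
    1 ≤ n → Connected G → 1 ≤ r → MinDegreeAtLeast r G →
    Σ ℕ λ m → IsMinImmortalSize r G m ×
      ((r ≡ 1 → m ≡ 1) ×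
       (r ≡ 2 → 2 ≤ m × m * (1 + parityX n) ≤ n) ×
       (3 ≤ r → r ≤ m × m ≤ n))
theorem8 n@(suc _) G r _ connected _ δ≥r
  with m , (I , immortal , refl) , minimal ← minimum-exists G r (full-immortal G r δ≥r zero)
  = m , ((I , immortal , refl) , minimal) , r≡1⇒m≡1 , r≡2⇒bounds , λ _ → r≤m , m≤n
  where
  r≤m : r ≤ ∣ I ∣
  r≤m = immortal⇒r≤∣I∣ G r immortal

  m≤n : ∣ I ∣ ≤ n
  m≤n = subst (∣ I ∣ ≤_) (∣⊤∣≡n n) (minimal ⊤ (full-immortal G r δ≥r zero))

  r≡1⇒m≡1 : r ≡ 1 → ∣ I ∣ ≡ 1
  r≡1⇒m≡1 refl =
    ≤-antisym (subst (∣ I ∣ ≤_) (∣⁅x⁆∣≡1 {n = n} zero) (minimal ⁅ zero ⁆ (singleton-immortal G δ≥r zero))) r≤m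

  r≡2⇒bounds : r ≡ 2 → 2 ≤ ∣ I ∣ × ∣ I ∣ * (1 + parityX n) ≤ n
  r≡2⇒bounds refl = r≤m , minimum-parity-bound G minimal δ≥r connected zero m≤n
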